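{- Let $k\ge1$, $L\ge0$, $n=4k\cdot 2^L$, $F\in\{0,1\}^n$, $F'$ any binary string, $o\in\mathbb{N}$, $R$ any randomness table, and $\ell\in\{0,\dots,L\}$. Then there exists a level-$\ell$ monotone disjoint matching between $F$ and $F'$ under $\mathrm{hash}_{R,o}$ of size at least $4k\cdot 2^\ell-ED(F,F')$; in particular a maximum-size level-$\ell$ monotone disjoint matching between $F$ and $F'$ (as computed in level $\ell$ of the recovery algorithm when the level-$\ell$ hashes of $F$ are known correctly) has size at least $4k\cdot2^\ell-ED(F,F')$.
   Context: $R$ is a three-dimensional table of bits $R[p,\ell,i]$. For $o\in\mathbb{N}$, a bit string $S$, an offset $s\ge0$ and a level $\ell$, the hash $\mathrm{hash}_{R,o}(S,s,\ell)$ is the $o$-bit string $h_1,\dots,h_o$ with $h_i=\bigoplus_{j=1}^{|S|}\big(S[j]\cdot R[s+j-1,\ell,i]\big)$, except that if $o>|S|$ it outputs $S$ padded with zeros to length $o$. $S[a,b]$ denotes the substring from position $a$ to $b$ inclusive (positions start at 1). Level-$\ell$ blocks of $F$ have length $b_\ell=2^{L-\ell}$. A level-$\ell$ size-$m$ matching between $F$ and $F'$ under $\mathrm{hash}_{R,o}$ consists of indices $i_1\le i_2\le\dots\le i_m$ in $[1,n-b_\ell+1]$ and $i'_1,\dots,i'_m$ in $[1,|F'|-b_\ell+1]$ such that each $i_j-1$ is a multiple of $b_\ell$ and $\mathrm{hash}_{R,o}(F[i_j,i_j+b_\ell-1],i_j-1,\ell)=\mathrm{hash}_{R,o}(F'[i'_j,i'_j+b_\ell-1],i_j-1,\ell)$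 for all $j$. It is monotone if $i'_1\le\dots\le i'_m$, and disjoint if $|i'_j-i'_{j'}|\ge b_\ell$ for all $j\ne j'$. $ED$ denotes edit distance (insertions, deletions, substitutions). -}

module Defs where

open import Data.Bool using (Bool; true; false; _∧_; _xor_; if_then_else_)
open import Data.Nat using (ℕ; zero; suc; _+_; _*_; _∸_; _^_; _≤_; _<_; _<?_; _⊓_; ∣_-_∣)
open import Relation.Nullary using (yes; no)
open import Data.Nat.Divisibility using (_∣_)
open import Data.List using (List; []; _∷_; length; take; drop; replicate; _++_; map; upTo)
open import Data.Fin using (Fin)
import Data.Fin as Fin
open import Data.Product using (Σ; _×_)
open import Relation.Binary.PropositionalEquality using (_≡_; _≢_)

-- Bit strings are lists of booleans (position 1 = head of the list).
BitString : Set
BitString = List Bool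

-- Randomness table R[p, ℓ, i].
Table : Set
Table = ℕ → ℕ → ℕ → Bool

-- ⊕_{j=1}^{|S|} S[j] · R[s+j-1, ℓ, i]   (here `p` runs through s+j-1)
hashBit : Table → BitString → ℕ → ℕ → ℕ → Bool
hashBit R []       p ℓ i = false
hashBit R (x ∷ xs) p ℓ i = (x ∧ R p ℓ i) xor hashBit R xs (suc p) ℓ i

hash : Table → ℕ → BitString → ℕ → ℕ → BitString
hash R o S s ℓ with length S <? o
... | yes _ = S ++ replicate (o ∸ length S) false
... | no  _ = map (λ i → hashBit R S s ℓ (suc i)) (upTo o)

-- Substring S[a, a+b-1] (1-based position a, length b).
sub : BitString → ℕ → ℕ → BitString
sub S a b = take b (drop (a ∸ 1) S)

mismatch : Bool → Bool → ℕ
mismatch true  true  = 0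
mismatch false false = 0
mismatch _     _     = 1

ED : BitString → BitString → ℕ
ED []       ys       = length ys
ED (x ∷ xs) []       = suc (length xs)
ED (x ∷ xs) (y ∷ ys) =
  suc (ED xs (y ∷ ys)) ⊓ (suc (ED (x ∷ xs) ys) ⊓ (ED xs ys + mismatch x y))

blockLen : ℕ → ℕ → ℕ
blockLen L ℓ = 2 ^ (L ∸ ℓ)

record MonDisjMatching (L : ℕ) (R : Table) (o : ℕ) (ℓ : ℕ)
                       (F F' : BitString) (m : ℕ) : Set where
  field
    i  : Fin m → ℕ
    i' : Fin m → ℕ
    i-lower  : ∀ j → 1 ≤ i j
    i-upper  : ∀ j → i j + blockLen L ℓ ≤ length F + 1
    i'-lower : ∀ j → 1 ≤ i' j
    i'-upper : ∀ j → i' j + blockLen L ℓ ≤ length F' + 1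
    aligned  : ∀ j → blockLen L ℓ ∣ (i j ∸ 1)
    hashEq   : ∀ j → hash R o (sub F (i j) (blockLen L ℓ)) (i j ∸ 1) ℓ
                   ≡ hash R o (sub F' (i' j) (blockLen L ℓ)) (i j ∸ 1) ℓ
    i-mono   : ∀ j j' → j Fin.≤ j' → i j ≤ i j'
    i'-mono  : ∀ j j' → j Fin.≤ j' → i' j ≤ i' j'
    disjoint : ∀ j j' → j ≢ j' → blockLen L ℓ ≤ ∣ i' j - i' j' ∣

module Submission where

-- A greedy block-by-block matching realises the bound.
--
-- Cut F into N = 4k·2^ℓ consecutive level-ℓ blocks B₁ … B_N of length
-- b = 2^(L-ℓ).  Edit distance is superadditive along a cut of its first
-- argument: every F' can be written as u₁ ++ … ++ u_N with
-- Σ ED(B_j, u_j) ≤ ED(F, F') (lemma splitED).  A block with ED(B_j, u_j) = 0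
-- occurs verbatim in F' at position |u₁ … u_{j-1}| + 1, so it contributes a
-- matched pair with equal hashes; every other block costs at least 1.
-- Hence at least N - ED(F, F') blocks are matched, and the pairs are
-- automatically aligned, monotone and disjoint.

open import Defs
open import Data.Bool using (Bool; true; false)
open import Data.Nat
open import Data.Nat.Properties
open import Data.Nat.Divisibility using (_∣_; ∣-refl; _∣0; ∣m∣n⇒∣m+n)
open import Data.List using (List; []; _∷_; length; _++_; take; drop)
open import Data.List.Properties using (length-take; length-drop; take++drop≡id; drop-drop; length-++)
open import Data.Fin using (Fin; zero; suc)
import Data.Fin as Fin
open import Data.Vec.Functional using () renaming (_∷_ to _◂_)
open import Data.Product using (Σ; Σ-syntax; _×_; _,_)
open import Data.Sum using (inj₁; inj₂)
open import Relation.Nullary using (Dec; yes; no; contradiction)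
open import Relation.Binary.PropositionalEquality

ED-[]ʳ : ∀ (xs : List Bool) → ED xs [] ≡ length xs
ED-[]ʳ []      = refl
ED-[]ʳ (_ ∷ _) = refl

ED-delete : ∀ a (xs ys : List Bool) → ED (a ∷ xs) ys ≤ suc (ED xs ys)
ED-delete a xs []       = ≤-reflexive (cong suc (sym (ED-[]ʳ xs)))
ED-delete a xs (y ∷ ys) = m⊓n≤m _ _

ED-insert : ∀ a y (xs ys : List Bool) → ED (a ∷ xs) (y ∷ ys) ≤ suc (ED (a ∷ xs) ys)
ED-insert a y xs ys = ≤-trans (m⊓n≤n _ _) (m⊓n≤m _ _)

ED-substitute : ∀ a y (xs ys : List Bool) → ED (a ∷ xs) (y ∷ ys) ≤ ED xs ys + mismatch a y
ED-substitute a y xs ys = ≤-trans (m⊓n≤n _ _) (m⊓n≤n _ _)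

record Splits (A X ys : List Bool) (c : ℕ) : Set where
  constructor splitting
  field
    left right : List Bool
    glue       : ys ≡ left ++ right
    cost       : ED A left + ED X right ≤ c

splits-⊓ : ∀ {A X ys} c₁ c₂ → Splits A X ys c₁ → Splits A X ys c₂ → Splits A X ys (c₁ ⊓ c₂)
splits-⊓ c₁ c₂ s₁ s₂ with ⊓-sel c₁ c₂
... | inj₁ c₁⊓c₂≡c₁ rewrite c₁⊓c₂≡c₁ = s₁
... | inj₂ c₁⊓c₂≡c₂ rewrite c₁⊓c₂≡c₂ = s₂

split-delete : ∀ {a A X ys c} → Splits A X ys c → Splits (a ∷ A) X ys (suc c)
split-delete {a} {A} {X} (splitting u v ys≡ cost) =
  splitting u v ys≡ (≤-trans (+-monoˡ-≤ _ (ED-delete a A u)) (s≤s cost))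

split-insert : ∀ {a A X y ys c} → Splits (a ∷ A) X ys c → Splits (a ∷ A) X (y ∷ ys) (suc c)
split-insert {a} {A} {y = y} (splitting u v ys≡ cost) =
  splitting (y ∷ u) v (cong (y ∷_) ys≡) (≤-trans (+-monoˡ-≤ _ (ED-insert a y A u)) (s≤s cost))

split-substitute : ∀ {a A X y ys c} → Splits A X ys c →
                   Splits (a ∷ A) X (y ∷ ys) (c + mismatch a y)
split-substitute {a} {A} {X} {y} (splitting u v ys≡ cost) =
  splitting (y ∷ u) v (cong (y ∷_) ys≡) (begin
    ED (a ∷ A) (y ∷ u) + ED X v      ≤⟨ +-monoˡ-≤ _ (ED-substitute a y A u) ⟩
    ED A u + mismatch a y + ED X v   ≡⟨ +-assoc (ED A u) (mismatch a y) (ED X v) ⟩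
    ED A u + (mismatch a y + ED X v) ≡⟨ cong (ED A u +_) (+-comm (mismatch a y) (ED X v)) ⟩
    ED A u + (ED X v + mismatch a y) ≡⟨ +-assoc (ED A u) (ED X v) (mismatch a y) ⟨
    ED A u + ED X v + mismatch a y   ≤⟨ +-monoˡ-≤ _ cost ⟩
    _                                ∎)
  where open ≤-Reasoning

splitED : ∀ (A X ys : List Bool) → Splits A X ys (ED (A ++ X) ys)
splitED []      X ys       = splitting [] ys refl ≤-refl
splitED (a ∷ A) X []       =
  splitting [] [] refl (≤-reflexive (cong suc (trans (cong (length A +_) (ED-[]ʳ X)) (sym (length-++ A)))))
splitED (a ∷ A) X (y ∷ ys) =
  splits-⊓ _ _ (split-delete (splitED A X (y ∷ ys)))
    (splits-⊓ _ _ (split-insert (splitED (a ∷ A) X ys)) (split-substitute (splitED A X ys)))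

splitEDAt : ∀ n (X ys : List Bool) → Splits (take n X) (drop n X) ys (ED X ys)
splitEDAt n X ys = subst (λ Z → Splits (take n X) (drop n X) ys (ED Z ys))
                         (take++drop≡id n X) (splitED (take n X) (drop n X) ys)

suc⊓≡0 : ∀ m n → suc m ⊓ n ≡ 0 → n ≡ 0
suc⊓≡0 m zero    _ = refl
suc⊓≡0 m (suc n) ()

mismatch≡0 : ∀ a y → mismatch a y ≡ 0 → a ≡ y
mismatch≡0 true  true  _ = refl
mismatch≡0 false false _ = refl
mismatch≡0 true  false ()
mismatch≡0 false true  ()

ED≡0 : ∀ (xs ys : List Bool) → ED xs ys ≡ 0 → xs ≡ ys
ED≡0 []       []       _ = refl
ED≡0 (x ∷ xs) (y ∷ ys) e =
  cong₂ _∷_ (mismatch≡0 x y (m+n≡0⇒n≡0 (ED xs ys) substitution))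
            (ED≡0 xs ys (m+n≡0⇒m≡0 (ED xs ys) substitution))
  where
  substitution : ED xs ys + mismatch x y ≡ 0
  substitution = suc⊓≡0 _ _ (suc⊓≡0 _ _ e)

take-length-++ : ∀ (u v : List Bool) → take (length u) (u ++ v) ≡ u
take-length-++ []      v = refl
take-length-++ (x ∷ u) v = cong (x ∷_) (take-length-++ u v)

drop-length-++ : ∀ (u v : List Bool) → drop (length u) (u ++ v) ≡ v
drop-length-++ []      v = refl
drop-length-++ (x ∷ u) v = drop-length-++ u v

sharedPrefix : ∀ {b} {X Y u v : List Bool} → b ≤ length X → take b X ≡ u → Y ≡ u ++ v →
               length u ≡ b × b ≤ length Y × take b X ≡ take b Y
sharedPrefix {b} {X} {Y} {u} {v} b≤X refl refl = |u|≡b , b≤Y , sameStart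
  where
  |u|≡b : length u ≡ b
  |u|≡b = trans (length-take b X) (m≤n⇒m⊓n≡m b≤X)
  b≤Y : b ≤ length Y
  b≤Y = subst (_≤ length Y) |u|≡b (≤-trans (m≤m+n (length u) (length v)) (≤-reflexive (sym (length-++ u))))
  sameStart : u ≡ take b Y
  sameStart = sym (trans (cong (λ n → take n Y) (sym |u|≡b)) (take-length-++ u v))

drop-fits : ∀ p (xs : List Bool) {b} → 1 ≤ b → b ≤ length (drop p xs) → p + b ≤ length xs
drop-fits zero    xs       _   h = h
drop-fits (suc p) []       1≤b h = contradiction (≤-trans 1≤b h) λ ()
drop-fits (suc p) (x ∷ xs) 1≤b h = s≤s (drop-fits p xs 1≤b h)

∀-◂ : ∀ {m} (P : ℕ → Set) {x} {f : Fin m → ℕ} → P x → (∀ j → P (f j)) → ∀ j → P ((x ◂ f) j)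
∀-◂ P px pf zero    = px
∀-◂ P px pf (suc j) = pf j

mono-◂ : ∀ {m x} {f : Fin m → ℕ} → (∀ j → x ≤ f j) →
         (∀ j j' → j Fin.≤ j' → f j ≤ f j') →
         ∀ j j' → j Fin.≤ j' → (x ◂ f) j ≤ (x ◂ f) j'
mono-◂ below mono zero    zero     _       = ≤-refl
mono-◂ below mono zero    (suc j') _       = below j'
mono-◂ below mono (suc j) (suc j') (s≤s le) = mono j j' le

spread-◂ : ∀ {m x b} {f : Fin m → ℕ} → (∀ j → x + b ≤ f j) →
           (∀ j j' → j ≢ j' → b ≤ ∣ f j - f j' ∣) →
           ∀ j j' → j ≢ j' → b ≤ ∣ (x ◂ f) j - (x ◂ f) j' ∣
spread-◂ below spread zero    zero     ne = contradiction refl ne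
spread-◂ below spread zero    (suc j') _  = gap (below j')
  where
  gap : ∀ {x b y} → x + b ≤ y → b ≤ ∣ x - y ∣
  gap {x} {b} {y} h = ≤-trans (m+n≤o⇒m≤o∸n b (≤-trans (≤-reflexive (+-comm b x)) h))
                        (≤-trans (m∸n≤∣m-n∣ y x) (≤-reflexive (∣-∣-comm y x)))
spread-◂ {x = x} {f = f} below spread (suc j) zero _ =
  ≤-trans (spread-◂ below spread zero (suc j) λ ()) (≤-reflexive (∣-∣-comm x (f j)))
spread-◂ below spread (suc j) (suc j') ne = spread j j' λ e → ne (cong suc e)

module Greedy (L : ℕ) (R : Table) (o ℓ : ℕ) (F F' : List Bool) where

  b : ℕ
  b = blockLen L ℓ

  open MonDisjMatching

  record MatchingAfter (p q m : ℕ) : Set where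
    field
      matching : MonDisjMatching L R o ℓ F F' m
      after    : ∀ j → p < i matching j
      after'   : ∀ j → q < i' matching j
  open MatchingAfter

  noMatching : ∀ p q → MatchingAfter p q 0
  noMatching p q = record
    { matching = record
      { i = λ () ; i' = λ () ; i-lower = λ () ; i-upper = λ () ; i'-lower = λ ()
      ; i'-upper = λ () ; aligned = λ () ; hashEq = λ () ; i-mono = λ ()
      ; i'-mono = λ () ; disjoint = λ () }
    ; after = λ () ; after' = λ () }

  shift : ∀ {p q p' q' m} → p ≤ p' → q ≤ q' → MatchingAfter p' q' m → MatchingAfter p q m
  shift p≤p' q≤q' G = record
    { matching = matching G
    ; after    = λ j → ≤-<-trans p≤p' (after G j)
    ; after'   = λ j → ≤-<-trans q≤q' (after' G j) }

  extend : ∀ {p q m} → b ∣ p → p + b ≤ length F → q + b ≤ length F' →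
           take b (drop p F) ≡ take b (drop q F') →
           MatchingAfter (p + b) (q + b) m → MatchingAfter p q (suc m)
  extend {p} {q} b∣p p+b≤ q+b≤ sameBlock G = record
    { matching = record
      { i        = I
      ; i'       = I'
      ; i-lower  = ∀-◂ (1 ≤_) (s≤s z≤n) (i-lower M)
      ; i-upper  = ∀-◂ (λ x → x + b ≤ length F + 1)
                       (≤-trans (s≤s p+b≤) (≤-reflexive (+-comm 1 (length F)))) (i-upper M)
      ; i'-lower = ∀-◂ (1 ≤_) (s≤s z≤n) (i'-lower M)
      ; i'-upper = ∀-◂ (λ x → x + b ≤ length F' + 1)
                       (≤-trans (s≤s q+b≤) (≤-reflexive (+-comm 1 (length F')))) (i'-upper M)
      ; aligned  = ∀-◂ (λ x → b ∣ x ∸ 1) b∣p (aligned M)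
      ; hashEq   = sameHash
      ; i-mono   = mono-◂ (λ j → beyond p (after G j)) (i-mono M)
      ; i'-mono  = mono-◂ (λ j → beyond q (after' G j)) (i'-mono M)
      ; disjoint = spread-◂ (after' G) (disjoint M) }
    ; after  = ∀-◂ (p <_) ≤-refl (λ j → beyond p (after G j))
    ; after' = ∀-◂ (q <_) ≤-refl (λ j → beyond q (after' G j)) }
    where
    M = matching G
    I = suc p ◂ i M
    I' = suc q ◂ i' M
    beyond : ∀ x {y} → x + b < y → x < y
    beyond x = ≤-<-trans (m≤m+n x b)
    sameHash : ∀ j → hash R o (sub F (I j) b) (I j ∸ 1) ℓ ≡ hash R o (sub F' (I' j) b) (I j ∸ 1) ℓ
    sameHash zero    = cong (λ S → hash R o S p ℓ) sameBlock
    sameHash (suc j) = hashEq M j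

  dropBlock : ∀ {N} p (xs : List Bool) → length (drop p xs) ≡ suc N * b →
              length (drop (p + b) xs) ≡ N * b
  dropBlock {N} p xs len = begin
    length (drop (p + b) xs)     ≡⟨ cong length (drop-drop p b xs) ⟨
    length (drop b (drop p xs))  ≡⟨ length-drop b (drop p xs) ⟩
    length (drop p xs) ∸ b       ≡⟨ cong (_∸ b) len ⟩
    b + N * b ∸ b                ≡⟨ m+n∸m≡n b (N * b) ⟩
    N * b                        ∎
    where open ≡-Reasoning

  blocks : 1 ≤ b → ∀ N p q → b ∣ p → length (drop p F) ≡ N * b →
           Σ[ m ∈ ℕ ] MatchingAfter p q m × (N ≤ ED (drop p F) (drop q F') + m)
  blocks 1≤b zero    p q _   _   = 0 , noMatching p q , z≤n
  blocks 1≤b (suc N) p q b∣p len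
    with splitting u v rest≡uv cost ← splitEDAt b (drop p F) (drop q F')
    with m , G , bound ← blocks 1≤b N (p + b) (q + length u) (∣m∣n⇒∣m+n b∣p ∣-refl) (dropBlock {N} p F len)
    = blockStep (ED (take b (drop p F)) u ≟ 0)
    where
    X = drop p F
    Y = drop q F'
    B = take b X
    E' = ED (drop (p + b) F) (drop (q + length u) F')
    split-cost : ED B u + E' ≤ ED X Y
    split-cost = subst₂ (λ Z W → ED B u + ED Z W ≤ ED X Y) (drop-drop p b F) restSuffix cost
      where
      restSuffix : v ≡ drop (q + length u) F'
      restSuffix = trans (sym (drop-length-++ u v))
                         (trans (cong (drop (length u)) (sym rest≡uv)) (drop-drop q (length u) F'))
    b≤X : b ≤ length X
    b≤X = ≤-trans (m≤m+n b (N * b)) (≤-reflexive (sym len))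
    blockStep : Dec (ED B u ≡ 0) →
                Σ[ m ∈ ℕ ] MatchingAfter p q m × (suc N ≤ ED X Y + m)
    -- The block occurs verbatim as u: one more matched pair.
    blockStep (yes zeroCost)
      with |u|≡b , b≤Y , sameBlock ← sharedPrefix b≤X (ED≡0 B u zeroCost) rest≡uv =
      suc m , extend b∣p (drop-fits p F 1≤b b≤X) (drop-fits q F' 1≤b b≤Y) sameBlock
                     (shift ≤-refl (≤-reflexive (cong (q +_) (sym |u|≡b))) G) ,
      ≤-trans (s≤s (≤-trans bound (+-monoˡ-≤ m (m+n≤o⇒n≤o (ED B u) split-cost))))
              (≤-reflexive (sym (+-suc (ED X Y) m)))
    -- The block costs at least one edit: the old matching suffices.
    blockStep (no positiveCost) =
      m , shift (m≤m+n p b) (m≤m+n q (length u)) G ,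
      ≤-trans (s≤s bound) (+-monoˡ-≤ m (≤-trans (+-monoˡ-≤ E' (n≢0⇒n>0 positiveCost)) split-cost))

blocksPerLevel : ∀ {ℓ L} → ℓ ≤ L → 2 ^ ℓ * blockLen L ℓ ≡ 2 ^ L
blocksPerLevel {ℓ} {L} ℓ≤L = trans (sym (^-distribˡ-+-* 2 ℓ (L ∸ ℓ))) (cong (2 ^_) (m+[n∸m]≡n ℓ≤L))

lemma1 : (k L : ℕ) → 1 ≤ k → (F F' : List Bool) → length F ≡ 4 * k * 2 ^ L →
    (o : ℕ) (R : Table) (ℓ : ℕ) → ℓ ≤ L →
    Σ ℕ (λ m → MonDisjMatching L R o ℓ F F' m × (4 * k * 2 ^ ℓ ∸ ED F F' ≤ m))
lemma1 k L _ F F' lenF o R ℓ ℓ≤L = conclude (blocks (m^n>0 2 (L ∸ ℓ)) N 0 0 (b ∣0) lenBlocks)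
  where
  open Greedy L R o ℓ F F'
  N = 4 * k * 2 ^ ℓ
  lenBlocks : length F ≡ N * b
  lenBlocks = trans lenF (trans (cong (4 * k *_) (sym (blocksPerLevel ℓ≤L))) (sym (*-assoc (4 * k) (2 ^ ℓ) b)))
  conclude : Σ[ m ∈ ℕ ] MatchingAfter 0 0 m × (N ≤ ED F F' + m) →
             Σ ℕ (λ m → MonDisjMatching L R o ℓ F F' m × (N ∸ ED F F' ≤ m))
  conclude (m , G , bound) = m , MatchingAfter.matching G , m≤n+o⇒m∸n≤o N (ED F F') bound
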